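{- Let $\Sigma$ be a finite vocabulary including the property name $r$, let $m$ be a natural number, let $E$ be an $\mathit{id}$-free path expression over $\Sigma$, and let $H$ be $G_{\mathit{eq}}(\Sigma,m)$ or $G'_{\mathit{eq}}(\Sigma,m)$. Then $[\![E]\!]^H\supseteq[\![r]\!]^H$ or $[\![E]\!]^H\supseteq[\![r^-]\!]^H$.
   Context: Fix two disjoint infinite sets $N$ (node names) and $P$ (property names). Path expressions: $E ::= \mathit{id} \mid p \mid p^- \mid E\cup E \mid E\circ E \mid E^*$, $p\in P$; $\mathit{id}$-free means $\mathit{id}$ does not occur; $E$ is over $\Sigma\subseteq N\cup P$ if all its property names lie in $\Sigma$. A graph is a finite set of triples $(a,p,b)$, $a,b\in N$, $p\in P$. Semantics (domain $N$): $[\![p]\!]^G=\{(a,b):(a,p,b)\in G\}$, $\mathit{id}$ identity on $N$, $p^-$ inverse, $\cup$ union, $\circ$ composition, $E^*$ reflexive-transitive closure on $N$. Graphs $G_{\mathit{eq}}(\Sigma,m)$ and $G'_{\mathit{eq}}(\Sigma,m)$: choose a set $V$ of node names not in $\Sigma$ with $|V|=\max(3,m+1)$ and fix two distinct nodes $a,b\in V$. In $G_{\mathit{eq}}(\Sigma,m)$, for each property name $p\in\Sigma\cap P$ the set of $p$-edges is $V\times V\setminus\{(b,a)\}$; in $G'_{\mathit{eq}}(\Sigma,m)$ it is $V\times V$; there are no other triples. -}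

module Defs where

open import Data.Nat using (ℕ; _≟_)
open import Data.Sum using (_⊎_; inj₁; inj₂)
open import Data.Product using (_×_; _,_; ∃-syntax)
open import Data.List using (List; []; _∷_; concatMap)
open import Data.List.Membership.Propositional using (_∈_)
open import Data.Bool using (if_then_else_; _∧_)
open import Relation.Nullary.Decidable using (⌊_⌋)
open import Relation.Binary.PropositionalEquality using (_≡_)
open import Relation.Binary.Construct.Closure.ReflexiveTransitive using (Star)

-- Node names N and property names P: two disjoint infinite sets.
-- Both are copies of ℕ; disjointness is realised by tagging in N ⊎ P.
N : Set
N = ℕ

P : Set
P = ℕ

Vocab : Set
Vocab = List (N ⊎ P)

data PathExpr : Set where
  idE  : PathExpr
  prop : P → PathExpr
  inv  : P → PathExpr
  _∪E_ : PathExpr → PathExpr → PathExpr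
  _∘E_ : PathExpr → PathExpr → PathExpr
  _*E  : PathExpr → PathExpr

data IdFree : PathExpr → Set where
  prop-idf : ∀ p → IdFree (prop p)
  inv-idf  : ∀ p → IdFree (inv p)
  ∪-idf    : ∀ {E F} → IdFree E → IdFree F → IdFree (E ∪E F)
  ∘-idf    : ∀ {E F} → IdFree E → IdFree F → IdFree (E ∘E F)
  *-idf    : ∀ {E} → IdFree E → IdFree (E *E)

data Over (Σ : Vocab) : PathExpr → Set where
  id-over   : Over Σ idE
  prop-over : ∀ {p} → inj₂ p ∈ Σ → Over Σ (prop p)
  inv-over  : ∀ {p} → inj₂ p ∈ Σ → Over Σ (inv p)
  ∪-over    : ∀ {E F} → Over Σ E → Over Σ F → Over Σ (E ∪E F)
  ∘-over    : ∀ {E F} → Over Σ E → Over Σ F → Over Σ (E ∘E F)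
  *-over    : ∀ {E} → Over Σ E → Over Σ (E *E)

Graph : Set
Graph = List (N × P × N)

Edge : Graph → N → P → N → Set
Edge G a p b = (a , p , b) ∈ G

⟦_⟧ : PathExpr → Graph → N → N → Set
⟦ idE ⟧    G x y = x ≡ y
⟦ prop p ⟧ G x y = Edge G x p y
⟦ inv p ⟧  G x y = Edge G y p x
⟦ E ∪E F ⟧ G x y = ⟦ E ⟧ G x y ⊎ ⟦ F ⟧ G x y
⟦ E ∘E F ⟧ G x y = ∃[ z ] (⟦ E ⟧ G x z × ⟦ F ⟧ G z y)
⟦ E *E ⟧   G x y = Star (⟦ E ⟧ G) x y

_⊆R_ : (N → N → Set) → (N → N → Set) → Set
R ⊆R S = ∀ x y → R x y → S x y

-- G_eq(Σ, m) built from the chosen V and a, b: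
-- for p ∈ Σ ∩ P, p-edges are V × V minus (b, a).
Geq : Vocab → List N → N → N → Graph
Geq Σ V a b = concatMap edges Σ
  where
  edges : N ⊎ P → Graph
  edges (inj₁ _) = []
  edges (inj₂ p) = concatMap (λ x → concatMap (λ y →
      if ⌊ x ≟ b ⌋ ∧ ⌊ y ≟ a ⌋ then [] else ((x , p , y) ∷ [])) V) V

Geq' : Vocab → List N → Graph
Geq' Σ V = concatMap edges Σ
  where
  edges : N ⊎ P → Graph
  edges (inj₁ _) = []
  edges (inj₂ p) = concatMap (λ x → concatMap (λ y → (x , p , y) ∷ []) V) V

{-# OPTIONS --safe #-}
-- Let c be a node of V other than a and b (it exists because |V| ≥ 3). In G_eq every
-- property edge set is V × V minus one pair, and an induction on E shows that ⟦E⟧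
-- contains V × V minus (b , a) or V × V minus (a , b). Both of these contain every
-- pair into c and every pair out of c, so c is a hub and a composition contains all
-- of V × V. In G'_eq the same induction shows directly that ⟦E⟧ contains V × V.
module Submission where

open import Defs
open import Data.Nat using (ℕ; suc; _⊔_; _≟_; _≤_; s≤s)
open import Data.Nat.Properties using (m≤m⊔n)
open import Data.Bool using (Bool; false; _∧_; if_then_else_)
open import Data.Sum using (_⊎_; inj₁; inj₂; [_,_])
open import Data.Product using (_×_; _,_; ∃-syntax)
open import Data.List using (List; []; _∷_; length)
open import Data.List.Membership.Propositional using (_∈_; _∉_; find; lose)
open import Data.List.Membership.Propositional.Properties using (∈-concatMap⁻; ∈-concatMap⁺)
open import Data.List.Relation.Unary.Any using (here; there)
open import Data.List.Relation.Unary.All using (_∷_)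
open import Data.List.Relation.Unary.AllPairs using (_∷_)
open import Data.List.Relation.Unary.Unique.Propositional using (Unique)
open import Relation.Binary.PropositionalEquality using (_≡_; _≢_; refl; sym; subst; ≢-sym)
open import Relation.Binary.Construct.Closure.ReflexiveTransitive using (return)
open import Relation.Nullary using (¬_; Dec; yes; no; contradiction)
open import Relation.Nullary.Decidable using (⌊_⌋)

Square : List N → N → N → Set
Square V x y = x ∈ V × y ∈ V

Square∖ : List N → N → N → N → N → Set
Square∖ V u v x y = Square V x y × ¬ (x ≡ u × y ≡ v)

Square∖-flip : ∀ {V u v x y} → Square∖ V u v x y → Square∖ V v u y x
Square∖-flip ((x∈V , y∈V) , ¬uv) = (y∈V , x∈V) , λ (y≡v , x≡u) → ¬uv (x≡u , y≡v)

module _ {A B : Set} where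

  ⌊⌋∧⌊⌋≡false⇒¬× : (d : Dec A) (e : Dec B) → ⌊ d ⌋ ∧ ⌊ e ⌋ ≡ false → ¬ (A × B)
  ⌊⌋∧⌊⌋≡false⇒¬× (yes _) (yes _) ()
  ⌊⌋∧⌊⌋≡false⇒¬× (yes _) (no ¬b) _ (_ , b) = ¬b b
  ⌊⌋∧⌊⌋≡false⇒¬× (no ¬a) _       _ (a , _) = ¬a a

  ¬×⇒⌊⌋∧⌊⌋≡false : (d : Dec A) (e : Dec B) → ¬ (A × B) → ⌊ d ⌋ ∧ ⌊ e ⌋ ≡ false
  ¬×⇒⌊⌋∧⌊⌋≡false (yes a) (yes b) ¬ab = contradiction (a , b) ¬ab
  ¬×⇒⌊⌋∧⌊⌋≡false (yes _) (no _)  _   = refl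
  ¬×⇒⌊⌋∧⌊⌋≡false (no _)  _       _   = refl

∈-unless⁻ : ∀ {A : Set} {c : Bool} {z t : A} → z ∈ (if c then [] else t ∷ []) → c ≡ false × z ≡ t
∈-unless⁻ {c = false} (here z≡t) = refl , z≡t

∈-unless⁺ : ∀ {A : Set} {c : Bool} {t : A} → c ≡ false → t ∈ (if c then [] else t ∷ [])
∈-unless⁺ refl = here refl

module _ {Σ : Vocab} {V : List N} {x y : N} {p : P} where

  ∈-Geq⁻ : ∀ {a b} → (x , p , y) ∈ Geq Σ V a b → Square∖ V b a x y
  ∈-Geq⁻ {a} {b} e with find (∈-concatMap⁻ _ {xs = Σ} e)
  ... | inj₁ _ , _ , ()
  ... | inj₂ _ , _ , e₁ with find (∈-concatMap⁻ _ {xs = V} e₁)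
  ... | _ , x∈V , e₂ with find (∈-concatMap⁻ _ {xs = V} e₂)
  ... | _ , y∈V , e₃ with ∈-unless⁻ e₃
  ... | unless , refl = (x∈V , y∈V) , ⌊⌋∧⌊⌋≡false⇒¬× (x ≟ b) (y ≟ a) unless

  ∈-Geq⁺ : ∀ {a b} → inj₂ p ∈ Σ → Square∖ V b a x y → (x , p , y) ∈ Geq Σ V a b
  ∈-Geq⁺ {a} {b} p∈Σ ((x∈V , y∈V) , ¬ba) =
    ∈-concatMap⁺ _ (lose p∈Σ (∈-concatMap⁺ _ (lose x∈V (∈-concatMap⁺ _ (lose y∈V
      (∈-unless⁺ (¬×⇒⌊⌋∧⌊⌋≡false (x ≟ b) (y ≟ a) ¬ba)))))))

  ∈-Geq'⁻ : (x , p , y) ∈ Geq' Σ V → Square V x y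
  ∈-Geq'⁻ e with find (∈-concatMap⁻ _ {xs = Σ} e)
  ... | inj₁ _ , _ , ()
  ... | inj₂ _ , _ , e₁ with find (∈-concatMap⁻ _ {xs = V} e₁)
  ... | _ , x∈V , e₂ with find (∈-concatMap⁻ _ {xs = V} e₂)
  ... | _ , y∈V , here refl = x∈V , y∈V

  ∈-Geq'⁺ : inj₂ p ∈ Σ → Square V x y → (x , p , y) ∈ Geq' Σ V
  ∈-Geq'⁺ p∈Σ (x∈V , y∈V) =
    ∈-concatMap⁺ _ (lose p∈Σ (∈-concatMap⁺ _ (lose x∈V (∈-concatMap⁺ _ (lose y∈V (here refl))))))

≢-either : ∀ {y z : N} → y ≢ z → ∀ b → y ≢ b ⊎ z ≢ b
≢-either {y} y≢z b with y ≟ b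
... | yes refl = inj₂ (≢-sym y≢z)
... | no y≢b = inj₁ y≢b

∃-avoiding-two : ∀ {V : List N} → Unique V → 3 ≤ length V → ∀ a b → ∃[ c ] c ∈ V × c ≢ a × c ≢ b
∃-avoiding-two {x ∷ y ∷ z ∷ _} ((x≢y ∷ x≢z ∷ _) ∷ (y≢z ∷ _) ∷ _) (s≤s (s≤s (s≤s _))) a b
  with x ≟ a | x ≟ b
... | no x≢a | no x≢b = x , here refl , x≢a , x≢b
... | yes refl | _ with ≢-either y≢z b
...   | inj₁ y≢b = y , there (here refl) , ≢-sym x≢y , y≢b
...   | inj₂ z≢b = z , there (there (here refl)) , ≢-sym x≢z , z≢b
∃-avoiding-two {x ∷ y ∷ z ∷ _} ((x≢y ∷ x≢z ∷ _) ∷ (y≢z ∷ _) ∷ _) (s≤s (s≤s (s≤s _))) a b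
  | no _ | yes refl with ≢-either y≢z a
...   | inj₁ y≢a = y , there (here refl) , y≢a , ≢-sym x≢y
...   | inj₂ z≢a = z , there (there (here refl)) , z≢a , ≢-sym x≢z

module _ (Σ : Vocab) (H : Graph) (V : List N) {c : N} (c∈V : c ∈ V) where

  square⊆⟦⟧ : (∀ {p} → inj₂ p ∈ Σ → Square V ⊆R ⟦ prop p ⟧ H) →
    ∀ {E} → IdFree E → Over Σ E → Square V ⊆R ⟦ E ⟧ H
  square⊆⟦⟧ V⊆p (prop-idf _) (prop-over p∈Σ) x y = V⊆p p∈Σ x y
  square⊆⟦⟧ V⊆p (inv-idf _)  (inv-over p∈Σ)  x y (x∈V , y∈V) = V⊆p p∈Σ y x (y∈V , x∈V)
  square⊆⟦⟧ V⊆p (∪-idf E _)  (∪-over E/Σ _)  x y xy = inj₁ (square⊆⟦⟧ V⊆p E E/Σ x y xy)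
  square⊆⟦⟧ V⊆p (∘-idf E F)  (∘-over E/Σ F/Σ) x y (x∈V , y∈V) =
    c , square⊆⟦⟧ V⊆p E E/Σ x c (x∈V , c∈V) , square⊆⟦⟧ V⊆p F F/Σ c y (c∈V , y∈V)
  square⊆⟦⟧ V⊆p (*-idf E)    (*-over E/Σ)    x y xy = return (square⊆⟦⟧ V⊆p E E/Σ x y xy)

  module _ {a b : N} (c≢a : c ≢ a) (c≢b : c ≢ b) where

    Dichotomous : (N → N → Set) → Set
    Dichotomous R = (Square∖ V b a ⊆R R) ⊎ (Square∖ V a b ⊆R R)

    Dichotomous-mono : ∀ {R S} → R ⊆R S → Dichotomous R → Dichotomous S
    Dichotomous-mono R⊆S (inj₁ ba⊆R) = inj₁ λ x y xy → R⊆S x y (ba⊆R x y xy)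
    Dichotomous-mono R⊆S (inj₂ ab⊆R) = inj₂ λ x y xy → R⊆S x y (ab⊆R x y xy)

    Dichotomous-into : ∀ {R} → Dichotomous R → ∀ {x} → x ∈ V → R x c
    Dichotomous-into (inj₁ ba⊆R) x∈V = ba⊆R _ c ((x∈V , c∈V) , λ (_ , c≡a) → c≢a c≡a)
    Dichotomous-into (inj₂ ab⊆R) x∈V = ab⊆R _ c ((x∈V , c∈V) , λ (_ , c≡b) → c≢b c≡b)

    Dichotomous-outof : ∀ {R} → Dichotomous R → ∀ {y} → y ∈ V → R c y
    Dichotomous-outof (inj₁ ba⊆R) y∈V = ba⊆R c _ ((c∈V , y∈V) , λ (c≡b , _) → c≢b c≡b)
    Dichotomous-outof (inj₂ ab⊆R) y∈V = ab⊆R c _ ((c∈V , y∈V) , λ (c≡a , _) → c≢a c≡a)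

    dichotomous-⟦⟧ : (∀ {p} → inj₂ p ∈ Σ → Square∖ V b a ⊆R ⟦ prop p ⟧ H) →
      ∀ {E} → IdFree E → Over Σ E → Dichotomous (⟦ E ⟧ H)
    dichotomous-⟦⟧ ba⊆p (prop-idf _) (prop-over p∈Σ) = inj₁ (ba⊆p p∈Σ)
    dichotomous-⟦⟧ ba⊆p (inv-idf _)  (inv-over p∈Σ)  =
      inj₂ λ x y xy → ba⊆p p∈Σ y x (Square∖-flip xy)
    dichotomous-⟦⟧ ba⊆p (∪-idf E _)  (∪-over E/Σ _)  =
      Dichotomous-mono (λ _ _ → inj₁) (dichotomous-⟦⟧ ba⊆p E E/Σ)
    dichotomous-⟦⟧ ba⊆p (∘-idf E F)  (∘-over E/Σ F/Σ) = inj₁ λ _ _ ((x∈V , y∈V) , _) →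
      c , Dichotomous-into (dichotomous-⟦⟧ ba⊆p E E/Σ) x∈V
        , Dichotomous-outof (dichotomous-⟦⟧ ba⊆p F F/Σ) y∈V
    dichotomous-⟦⟧ ba⊆p (*-idf E)    (*-over E/Σ)    =
      Dichotomous-mono (λ _ _ → return) (dichotomous-⟦⟧ ba⊆p E E/Σ)

lemma3p14 : (Σ : Vocab) (r : P) → inj₂ r ∈ Σ → (m : ℕ) →
    (V : List N) → Unique V → length V ≡ 3 ⊔ suc m →
    (∀ v → v ∈ V → inj₁ v ∉ Σ) →
    (a b : N) → a ∈ V → b ∈ V → a ≢ b →
    (E : PathExpr) → IdFree E → Over Σ E →
    (H : Graph) → (H ≡ Geq Σ V a b ⊎ H ≡ Geq' Σ V) →
    (⟦ prop r ⟧ H ⊆R ⟦ E ⟧ H) ⊎ (⟦ inv r ⟧ H ⊆R ⟦ E ⟧ H)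
lemma3p14 Σ r _ m V V-unique |V| _ a b _ _ _ E E-idFree E/Σ H H≡
  with ∃-avoiding-two V-unique (subst (3 ≤_) (sym |V|) (m≤m⊔n 3 (suc m))) a b
... | c , c∈V , c≢a , c≢b with H≡
... | inj₁ refl =
  [ (λ ba⊆E → inj₁ λ x y e → ba⊆E x y (∈-Geq⁻ {Σ} e))
  , (λ ab⊆E → inj₂ λ x y e → ab⊆E x y (Square∖-flip (∈-Geq⁻ {Σ} e)))
  ] (dichotomous-⟦⟧ Σ H V c∈V c≢a c≢b (λ p∈Σ _ _ → ∈-Geq⁺ p∈Σ) E-idFree E/Σ)
... | inj₂ refl =
  inj₁ λ x y e → square⊆⟦⟧ Σ H V c∈V (λ p∈Σ _ _ → ∈-Geq'⁺ p∈Σ) E-idFree E/Σ x y (∈-Geq'⁻ {Σ} e)
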